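{- For every integer $n\ge 0$, $$j(n) = \sum_{m=0}^{n} p(n-m)\, d(m),$$ where $p(k)$ is the number of (ordinary) partitions of $k$ and $d(k)$ is the number of partitions of $k$ into distinct parts.
   Context: A 01-partition (jagged partition) of a non-negative integer $n$ is a finite sequence $(n_1,\dots,n_m)$ of non-negative integers with $\sum_i n_i = n$, whose last entry satisfies $n_m \geq 1$, and such that $n_j \geq n_{j+1}-1$ and $n_j \geq n_{j+2}$ whenever the indices are in range. The empty sequence is the unique 01-partition of $0$. $j(n)$ denotes the number of 01-partitions of $n$. -}

module Defs where

open import Data.Nat using (ℕ; zero; suc; _+_; _*_; _∸_; _≤_; _>_)
open import Data.List using (List; []; _∷_; map; upTo)
open import Data.Nat.ListAction using (sum)
open import Data.Product using (Σ; _×_)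
open import Data.Unit using (⊤)
open import Data.Fin using (Fin)
open import Function.Bundles using (_↔_)
open import Relation.Binary.PropositionalEquality using (_≡_)

JaggedConds : List ℕ → Set
JaggedConds []                = ⊤
JaggedConds (x ∷ [])          = ⊤
JaggedConds (x ∷ y ∷ [])      = y ≤ suc x
JaggedConds (x ∷ y ∷ z ∷ r)   = y ≤ suc x × z ≤ x × JaggedConds (y ∷ z ∷ r)

LastPositive : List ℕ → Set
LastPositive []           = ⊤
LastPositive (x ∷ [])     = x > 0
LastPositive (x ∷ y ∷ r)  = LastPositive (y ∷ r)

Is01Partition : ℕ → List ℕ → Set
Is01Partition n l = sum l ≡ n × LastPositive l × JaggedConds l

NonIncPos : List ℕ → Set
NonIncPos []              = ⊤
NonIncPos (x ∷ [])        = x > 0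
NonIncPos (x ∷ y ∷ r)     = y ≤ x × NonIncPos (y ∷ r)

IsPartition : ℕ → List ℕ → Set
IsPartition n l = sum l ≡ n × NonIncPos l

DecPos : List ℕ → Set
DecPos []                 = ⊤
DecPos (x ∷ [])           = x > 0
DecPos (x ∷ y ∷ r)        = x > y × DecPos (y ∷ r)

IsDistinctPartition : ℕ → List ℕ → Set
IsDistinctPartition n l = sum l ≡ n × DecPos l

Counts : (ℕ → ℕ) → (ℕ → List ℕ → Set) → Set
Counts f P = (n : ℕ) → Fin (f n) ↔ Σ (List ℕ) (P n)

convolution : (ℕ → ℕ) → (ℕ → ℕ) → ℕ → ℕ
convolution p d n = sum (map (λ m → p (n ∸ m) * d m) (upTo (suc n)))

-- A 01-partition is cut greedily from the left into blocks (x, x + 1) and single entries v;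
-- coding a block (x, x + 1) by the odd part 2x + 1 (of weight 2x + 1) and an entry v by the
-- even part 2v (of weight v) identifies 01-partitions with partitions in which the even parts
-- are halved. Separating even and odd parts gives J(q) = P(q) O(q), O counting partitions into
-- odd parts. Instead of proving O = D, multiply by P(q²): splitting the multiplicities of a
-- partition by the parity of the part gives O(q) P(q²) = P(q), and writing every multiplicity
-- as bit + 2 · half gives D(q) P(q²) = P(q). Hence J(q) P(q²) = P(q)² = P(q) D(q) P(q²), and
-- P(q²) cancels because its constant term is 1. A partition of weight at most K has parts at
-- most K, so such partitions are represented by multiplicity vectors of length K (or 2K), and
-- each generating-function identity is established coefficientwise up to such a bound.
{-# OPTIONS --safe #-}
module Submission where

open import Defs
open import Data.Bool using (Bool; true; false; if_then_else_)
open import Data.Empty using (⊥-elim)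
open import Data.Fin using (Fin; toℕ; fromℕ<) renaming (zero to fzero; suc to fsuc)
open import Data.Fin.Permutation using (↔⇒≡)
open import Data.Fin.Properties using (+↔⊎; *↔×; fromℕ<-toℕ; toℕ-fromℕ<; toℕ≤pred[n])
open import Data.List using (List; []; _∷_; _++_; map; drop; replicate; applyUpTo)
open import Data.List.Properties using (map-++; map-replicate; map-id; map-applyUpTo)
open import Data.Nat using (ℕ; zero; suc; _+_; _*_; _∸_; _≤_; _<_; _>_; s≤s; z≤n; z<s; s<s; pred; _≟_)
open import Data.Nat.Induction using (<-rec)
open import Data.Nat.ListAction using (sum)
open import Data.Nat.ListAction.Properties using (sum-++)
open import Data.Nat.Properties
open import Data.Nat.Tactic.RingSolver using (solve-∀)
open import Data.Product using (Σ; _×_; _,_; proj₁; proj₂; map₁; uncurry)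
import Data.Product as Product
open import Data.Product.Algebra using (×-assoc; ×-comm)
open import Data.Product.Function.Dependent.Propositional using (Σ-↔)
open import Data.Product.Function.NonDependent.Propositional using (_×-↔_)
open import Data.Sum using (_⊎_; inj₁; inj₂)
open import Data.Sum.Function.Propositional using (_⊎-↔_)
open import Data.Unit using (⊤; tt)
open import Data.Vec using (Vec; []; _∷_)
import Data.Vec as Vec
import Data.Vec.Properties as Vecₚ
open import Function using (_∘_; id)
open import Function.Bundles using (_↔_; Inverse; mk↔ₛ′)
open import Function.Construct.Composition using (_↔-∘_)
open import Function.Construct.Identity using (↔-id)
open import Function.Construct.Symmetry using (↔-sym)
open import Function.Related.Propositional using (module EquationalReasoning)
open import Level using (0ℓ)
open import Relation.Binary.PropositionalEquality
open import Relation.Nullary using (yes; no; contradiction)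
open import Relation.Unary using (Irrelevant)

private variable
  A B C D : Set
  K N n : ℕ

double : ℕ → ℕ
double zero = zero
double (suc n) = suc (suc (double n))

data Parity : ℕ → Set where
  even : ∀ k → Parity (double k)
  odd  : ∀ k → Parity (suc (double k))

parity : ∀ n → Parity n
parity zero = even zero
parity (suc zero) = odd zero
parity (suc (suc n)) with parity n
... | even k = even (suc k)
... | odd k = odd (suc k)

parity-double : ∀ k → parity (double k) ≡ even k
parity-double zero = refl
parity-double (suc k) rewrite parity-double k = refl

parity-suc-double : ∀ k → parity (suc (double k)) ≡ odd k
parity-suc-double zero = refl
parity-suc-double (suc k) rewrite parity-suc-double k = refl

double-injective : ∀ {m n} → double m ≡ double n → m ≡ n
double-injective {zero} {zero} _ = refl
double-injective {suc m} {suc n} eq = cong suc (double-injective (suc-injective (suc-injective eq)))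

double≢suc-double : ∀ m n → double m ≢ suc (double n)
double≢suc-double (suc m) (suc n) eq = double≢suc-double m n (suc-injective (suc-injective eq))

double-mono-≤ : ∀ {m n} → m ≤ n → double m ≤ double n
double-mono-≤ z≤n = z≤n
double-mono-≤ (s≤s m≤n) = s≤s (s≤s (double-mono-≤ m≤n))

double≤1+double⇒≤ : ∀ {m n} → double m ≤ suc (double n) → m ≤ n
double≤1+double⇒≤ {zero} _ = z≤n
double≤1+double⇒≤ {suc m} {suc n} (s≤s (s≤s le)) = s≤s (double≤1+double⇒≤ le)

double-cancel-≤ : ∀ {m n} → double m ≤ double n → m ≤ n
double-cancel-≤ le = double≤1+double⇒≤ (m≤n⇒m≤1+n le)

n≤double[n] : ∀ n → n ≤ double n
n≤double[n] zero = z≤n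
n≤double[n] (suc n) = s≤s (m≤n⇒m≤1+n (n≤double[n] n))

double≡+ : ∀ n → double n ≡ n + n
double≡+ zero = refl
double≡+ (suc n) = cong suc (trans (cong suc (double≡+ n)) (sym (+-suc n n)))

double-+ : ∀ m n → double (m + n) ≡ double m + double n
double-+ zero n = refl
double-+ (suc m) n = cong (suc ∘ suc) (double-+ m n)

double-* : ∀ m n → double m * n ≡ m * double n
double-* zero n = refl
double-* (suc m) n = trans (sym (+-assoc n n (double m * n))) (cong₂ _+_ (sym (double≡+ n)) (double-* m n))

*-double : ∀ m n → m * double n ≡ double (m * n)
*-double m n = trans (cong (m *_) (double≡+ n)) (trans (*-distribˡ-+ m n n) (sym (double≡+ (m * n))))

-- Counting weighted types

Fibre : (A → ℕ) → ℕ → Set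
Fibre {A} w n = Σ A (λ a → w a ≡ n)

CountsUpTo : ℕ → (ℕ → ℕ) → (A → ℕ) → Set
CountsUpTo N f w = ∀ n → n ≤ N → Fin (f n) ↔ Fibre w n

_⊕_ : (A → ℕ) → (B → ℕ) → A × B → ℕ
(wa ⊕ wb) (a , b) = wa a + wb b

module _ {wa : A → ℕ} {wb : B → ℕ} where

  Fibre-↔ : (φ : A ↔ B) → (∀ a → wb (Inverse.to φ a) ≡ wa a) → Fibre wa n ↔ Fibre wb n
  Fibre-↔ {n = n} φ preserves =
    Σ-↔ φ (λ {a} → subst (λ m → (wa a ≡ n) ↔ (m ≡ n)) (sym (preserves a)) (↔-id _))

  CountsUpTo-↔ : ∀ {f} (φ : A ↔ B) → (∀ a → wb (Inverse.to φ a) ≡ wa a) →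
                 CountsUpTo N f wa → CountsUpTo N f wb
  CountsUpTo-↔ φ preserves count n n≤N = Fibre-↔ φ preserves ↔-∘ count n n≤N

  CountsUpTo-↔⁻¹ : ∀ {f} (φ : A ↔ B) → (∀ a → wb (Inverse.to φ a) ≡ wa a) →
                   CountsUpTo N f wb → CountsUpTo N f wa
  CountsUpTo-↔⁻¹ φ preserves count n n≤N = ↔-sym (Fibre-↔ φ preserves) ↔-∘ count n n≤N

CountsUpTo-≤ : ∀ {N′ f} {w : A → ℕ} → N′ ≤ N → CountsUpTo N f w → CountsUpTo N′ f w
CountsUpTo-≤ N′≤N count n n≤N′ = count n (≤-trans n≤N′ N′≤N)

CountsUpTo-unique : ∀ {f g} {w : A → ℕ} → CountsUpTo N f w → CountsUpTo N g w →
                    n ≤ N → f n ≡ g n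
CountsUpTo-unique countf countg n≤N = ↔⇒≡ (↔-sym (countg _ n≤N) ↔-∘ countf _ n≤N)

CountsUpTo-regroup : ∀ {f} {wa : A → ℕ} {wb : B → ℕ} {wc : C → ℕ} {wd : D → ℕ}
                     (φ : (B × C) ↔ D) → (∀ x → wd (Inverse.to φ x) ≡ (wb ⊕ wc) x) →
                     CountsUpTo N f ((wa ⊕ wb) ⊕ wc) → CountsUpTo N f (wa ⊕ wd)
CountsUpTo-regroup {A = A} {B} {C} {wa = wa} {wb} {wc} φ preserves =
  CountsUpTo-↔ ((↔-id A ×-↔ φ) ↔-∘ ×-assoc 0ℓ A B C) regroup
  where
  regroup : ∀ (((a , b) , c) : (A × B) × C) → wa a + _ ≡ (wa a + wb b) + wc c
  regroup ((a , b) , c) = trans (cong (wa a +_) (preserves (b , c))) (sym (+-assoc (wa a) (wb b) (wc c)))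

Σ-↔-restrict : {P : A → Set} {Q : B → Set} → Irrelevant P → Irrelevant Q →
               (f : A → B) (g : B → A) → (∀ {a} → P a → Q (f a)) → (∀ {b} → Q b → P (g b)) →
               (∀ {a} → P a → g (f a) ≡ a) → (∀ {b} → Q b → f (g b) ≡ b) → Σ A P ↔ Σ B Q
Σ-↔-restrict P-irr Q-irr f g f-Q g-P g∘f f∘g =
  mk↔ₛ′ (λ (a , p) → f a , f-Q p) (λ (b , q) → g b , g-P q)
        (λ (b , q) → Σ-≡ Q-irr (f∘g q)) (λ (a , p) → Σ-≡ P-irr (g∘f p))
  where
  Σ-≡ : ∀ {C : Set} {R : C → Set} → Irrelevant R →
        ∀ {c c′} {r : R c} {r′ : R c′} → c ≡ c′ → (c , r) ≡ (c′ , r′)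
  Σ-≡ R-irr refl = cong (_ ,_) (R-irr _ _)

Split : ℕ → Set
Split n = Σ (ℕ × ℕ) (λ (i , k) → i + k ≡ n)

Split-≡ : {s t : Split n} → proj₂ (proj₁ s) ≡ proj₂ (proj₁ t) → s ≡ t
Split-≡ {s = (i , k) , e} {(i′ , .k) , e′} refl with +-cancelʳ-≡ k i i′ (trans e (sym e′))
... | refl = cong ((i , k) ,_) (≡-irrelevant e e′)

Fin-↔-Split : Fin (suc n) ↔ Split n
Fin-↔-Split {n} = mk↔ₛ′ split index (λ _ → Split-≡ (toℕ-fromℕ< _)) (λ i → fromℕ<-toℕ i _)
  where
  split : Fin (suc n) → Split n
  split i = (n ∸ toℕ i , toℕ i) , m∸n+n≡m (toℕ≤pred[n] i)
  index : Split n → Fin (suc n)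
  index ((i , k) , i+k≡n) = fromℕ< (s≤s (≤-trans (m≤n+m k i) (≤-reflexive i+k≡n)))

Σ-Split-Fibre-↔ : {wa : A → ℕ} {wb : B → ℕ} →
                  Σ (Split n) (λ ((i , k) , _) → Fibre wa i × Fibre wb k) ↔ Fibre (wa ⊕ wb) n
Σ-Split-Fibre-↔ {wa = wa} {wb} = mk↔ₛ′ join split (λ _ → refl) split-join
  where
  join : Σ (Split _) (λ ((i , k) , _) → Fibre wa i × Fibre wb k) → Fibre (wa ⊕ wb) _
  join (((._ , ._) , i+k≡n) , (a , refl) , (b , refl)) = (a , b) , i+k≡n
  split : Fibre (wa ⊕ wb) _ → Σ (Split _) (λ ((i , k) , _) → Fibre wa i × Fibre wb k)
  split ((a , b) , e) = ((wa a , wb b) , e) , (a , refl) , (b , refl)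
  split-join : ∀ s → split (join s) ≡ s
  split-join (((._ , ._) , _) , (a , refl) , (b , refl)) = refl

Σ-Fin-suc-↔ : {P : Fin (suc N) → Set} → (P fzero ⊎ Σ (Fin N) (P ∘ fsuc)) ↔ Σ (Fin (suc N)) P
Σ-Fin-suc-↔ {P = P} = mk↔ₛ′ to from to-from from-to
  where
  to : P fzero ⊎ Σ _ (P ∘ fsuc) → Σ _ P
  to (inj₁ p) = fzero , p
  to (inj₂ (i , p)) = fsuc i , p
  from : Σ _ P → P fzero ⊎ Σ _ (P ∘ fsuc)
  from (fzero , p) = inj₁ p
  from (fsuc i , p) = inj₂ (i , p)
  to-from : ∀ x → to (from x) ≡ x
  to-from (fzero , p) = refl
  to-from (fsuc i , p) = refl
  from-to : ∀ x → from (to x) ≡ x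
  from-to (inj₁ p) = refl
  from-to (inj₂ (i , p)) = refl

Fin-sum-↔ : ∀ (h : ℕ → ℕ) N → Fin (sum (applyUpTo h N)) ↔ Σ (Fin N) (λ i → Fin (h (toℕ i)))
Fin-sum-↔ h zero = mk↔ₛ′ (λ ()) (λ ()) (λ ()) (λ ())
Fin-sum-↔ h (suc N) = Σ-Fin-suc-↔ ↔-∘ ((↔-id _ ⊎-↔ Fin-sum-↔ (h ∘ suc) N) ↔-∘ +↔⊎)

convolution-applyUpTo : ∀ f g n → convolution f g n ≡ sum (applyUpTo (λ m → f (n ∸ m) * g m) (suc n))
convolution-applyUpTo f g n = cong sum (map-applyUpTo id (λ m → f (n ∸ m) * g m) (suc n))

Fin-convolution-↔ : ∀ {f g} → Fin (convolution f g n) ↔ Σ (Split n) (λ ((i , k) , _) → Fin (f i) × Fin (g k))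
Fin-convolution-↔ {n} {f} {g} rewrite convolution-applyUpTo f g n =
  Σ-↔ Fin-↔-Split *↔× ↔-∘ Fin-sum-↔ (λ m → f (n ∸ m) * g m) (suc n)

CountsUpTo-× : ∀ {f g} {wa : A → ℕ} {wb : B → ℕ} →
               CountsUpTo N f wa → CountsUpTo N g wb → CountsUpTo N (convolution f g) (wa ⊕ wb)
CountsUpTo-× {N} {f = f} {g} {wa} {wb} countA countB n n≤N =
  begin
    Fin (convolution f g n)                                  ↔⟨ Fin-convolution-↔ ⟩
    Σ (Split n) (λ ((i , k) , _) → Fin (f i) × Fin (g k))    ↔⟨ Σ-↔ (↔-id _) (λ {s} → factors s) ⟩
    Σ (Split n) (λ ((i , k) , _) → Fibre wa i × Fibre wb k)  ↔⟨ Σ-Split-Fibre-↔ ⟩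
    Fibre (wa ⊕ wb) n                                        ∎
  where
  open EquationalReasoning
  factors : (((i , k) , _) : Split n) → (Fin (f i) × Fin (g k)) ↔ (Fibre wa i × Fibre wb k)
  factors ((i , k) , i+k≡n) =
    countA i (≤-trans (m≤m+n i k) i+k≤N) ×-↔ countB k (≤-trans (m≤n+m k i) i+k≤N)
    where
    i+k≤N = ≤-trans (≤-reflexive i+k≡n) n≤N

-- If f is the coefficient sequence of F(q), then dilate f is that of F(q²).
dilate : (ℕ → ℕ) → ℕ → ℕ
dilate f n with parity n
... | even k = f k
... | odd _ = 0

CountsUpTo-dilate : ∀ {f} {w : A → ℕ} → CountsUpTo N f w → CountsUpTo N (dilate f) (double ∘ w)
CountsUpTo-dilate {A = A} {f = f} {w} count n n≤N with parity n
... | even k = Σ-↔ (↔-id A) double-↔ ↔-∘ count k (≤-trans (n≤double[n] k) n≤N)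
  where
  double-↔ : ∀ {a} → (w a ≡ k) ↔ (double (w a) ≡ double k)
  double-↔ = mk↔ₛ′ (cong double) double-injective (λ _ → ≡-irrelevant _ _) (λ _ → ≡-irrelevant _ _)
... | odd k = mk↔ₛ′ (λ ()) (λ (a , e) → ⊥-elim (double≢suc-double (w a) k e))
                         (λ (a , e) → ⊥-elim (double≢suc-double (w a) k e)) (λ ())

applyUpTo-cong : ∀ {h h′ : ℕ → A} N → (∀ m → m < N → h m ≡ h′ m) → applyUpTo h N ≡ applyUpTo h′ N
applyUpTo-cong zero _ = refl
applyUpTo-cong (suc N) eq = cong₂ _∷_ (eq 0 z<s) (applyUpTo-cong N (λ m m<N → eq (suc m) (s<s m<N)))

convolution-cancelʳ : ∀ {f g c} N → c 0 ≡ 1 → (∀ n → n ≤ N → convolution f c n ≡ convolution g c n) →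
                      ∀ n → n ≤ N → f n ≡ g n
convolution-cancelʳ {f} {g} {c} N c0≡1 same = <-rec (λ n → n ≤ N → f n ≡ g n) step
  where
  step : ∀ n → (∀ {m} → m < n → m ≤ N → f m ≡ g m) → n ≤ N → f n ≡ g n
  step n below n≤N = *-cancelʳ-≡ (f n) (g n) 1 (subst (λ x → f n * x ≡ g n * x) c0≡1 leading)
    where
    open ≡-Reasoning
    later : (ℕ → ℕ) → ℕ
    later h = sum (applyUpTo (λ m → h (n ∸ suc m) * c (suc m)) n)
    laters : later f ≡ later g
    laters = cong sum (applyUpTo-cong n (λ m m<n →
      let n∸sm<n = ∸-monoʳ-< z<s m<n in cong (_* c (suc m)) (below n∸sm<n (≤-trans (<⇒≤ n∸sm<n) n≤N))))
    leading : f n * c 0 ≡ g n * c 0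
    leading = +-cancelʳ-≡ (later f) _ _ (begin
      f n * c 0 + later f  ≡⟨ convolution-applyUpTo f c n ⟨
      convolution f c n    ≡⟨ same n n≤N ⟩
      convolution g c n    ≡⟨ convolution-applyUpTo g c n ⟩
      g n * c 0 + later g  ≡⟨ cong (g n * c 0 +_) laters ⟨
      g n * c 0 + later f  ∎)

OnHead : (ℕ → Set) → List ℕ → Set
OnHead P [] = ⊤
OnHead P (x ∷ _) = P x

OnHead-map : ∀ {P Q : ℕ → Set} → (∀ {x} → P x → Q x) → ∀ l → OnHead P l → OnHead Q l
OnHead-map P⇒Q [] _ = tt
OnHead-map P⇒Q (x ∷ _) p = P⇒Q p

OnHead-replicate-++ : ∀ {P : ℕ → Set} {x} m l → P x → OnHead P l → OnHead P (replicate m x ++ l)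
OnHead-replicate-++ zero l _ pl = pl
OnHead-replicate-++ (suc m) l px _ = px

OnHead-≤-sum : ∀ {M} l → sum l ≤ M → OnHead (_≤ M) l
OnHead-≤-sum [] _ = tt
OnHead-≤-sum (x ∷ l) sum≤M = ≤-trans (m≤m+n x (sum l)) sum≤M

NonIncPos-irrelevant : Irrelevant NonIncPos
NonIncPos-irrelevant {[]} _ _ = refl
NonIncPos-irrelevant {x ∷ []} = ≤-irrelevant
NonIncPos-irrelevant {x ∷ y ∷ l} (p , q) (p′ , q′) =
  cong₂ _,_ (≤-irrelevant p p′) (NonIncPos-irrelevant q q′)

NonIncPos-head : ∀ {x} l → NonIncPos (x ∷ l) → OnHead (_≤ x) l
NonIncPos-head [] _ = tt
NonIncPos-head (y ∷ l) (y≤x , _) = y≤x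

NonIncPos-tail : ∀ {x} l → NonIncPos (x ∷ l) → NonIncPos l
NonIncPos-tail [] _ = tt
NonIncPos-tail (y ∷ l) (_ , nonInc) = nonInc

NonIncPos-positive : ∀ {x} l → NonIncPos (x ∷ l) → x > 0
NonIncPos-positive [] x>0 = x>0
NonIncPos-positive (y ∷ l) (y≤x , nonInc) = ≤-trans (NonIncPos-positive l nonInc) y≤x

NonIncPos-∷ : ∀ {x} l → OnHead (_≤ x) l → NonIncPos l → (l ≡ [] → x > 0) → NonIncPos (x ∷ l)
NonIncPos-∷ [] _ _ x>0 = x>0 refl
NonIncPos-∷ (y ∷ l) y≤x nonInc _ = y≤x , nonInc

NonIncPos-replicate-++ : ∀ {c} m l → c > 0 → OnHead (_≤ c) l → NonIncPos l → NonIncPos (replicate m c ++ l)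
NonIncPos-replicate-++ zero l _ _ nonInc = nonInc
NonIncPos-replicate-++ (suc m) l c>0 l≤c nonInc =
  NonIncPos-∷ (replicate m _ ++ l) (OnHead-replicate-++ m l ≤-refl l≤c)
    (NonIncPos-replicate-++ m l c>0 l≤c nonInc) (λ _ → c>0)

DecPos-irrelevant : Irrelevant DecPos
DecPos-irrelevant {[]} _ _ = refl
DecPos-irrelevant {x ∷ []} = ≤-irrelevant
DecPos-irrelevant {x ∷ y ∷ l} (p , q) (p′ , q′) =
  cong₂ _,_ (≤-irrelevant p p′) (DecPos-irrelevant q q′)

DecPos-head : ∀ {x} l → DecPos (x ∷ l) → OnHead (_< x) l
DecPos-head [] _ = tt
DecPos-head (y ∷ l) (y<x , _) = y<x

DecPos-tail : ∀ {x} l → DecPos (x ∷ l) → DecPos l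
DecPos-tail [] _ = tt
DecPos-tail (y ∷ l) (_ , dec) = dec

DecPos-positive : ∀ {x} l → DecPos (x ∷ l) → x > 0
DecPos-positive [] x>0 = x>0
DecPos-positive (y ∷ l) (y<x , _) = ≤-trans (s≤s z≤n) y<x

DecPos-∷ : ∀ {x} l → OnHead (_< x) l → DecPos l → x > 0 → DecPos (x ∷ l)
DecPos-∷ [] _ _ x>0 = x>0
DecPos-∷ (y ∷ l) y<x dec _ = y<x , dec

-- Multiplicity vectors

-- Entry i of a vector in Vec ℕ M is the multiplicity of the part M ∸ i.
weight : (ℕ → ℕ) → ∀ {M} → Vec ℕ M → ℕ
weight wt [] = 0
weight wt {suc M} (m ∷ v) = m * wt (suc M) + weight wt v

weight-cong : ∀ {wt wt′} → (∀ k → wt k ≡ wt′ k) → ∀ {M} (v : Vec ℕ M) → weight wt v ≡ weight wt′ v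
weight-cong eq [] = refl
weight-cong eq {suc M} (m ∷ v) = cong₂ _+_ (cong (m *_) (eq (suc M))) (weight-cong eq v)

leadingCopies : ℕ → List ℕ → ℕ × List ℕ
leadingCopies c [] = 0 , []
leadingCopies c (x ∷ l) with x ≟ c
... | yes _ = map₁ suc (leadingCopies c l)
... | no _ = 0 , x ∷ l

leadingCopies-replicate-++ : ∀ {M} m l → OnHead (_≤ M) l →
                             leadingCopies (suc M) (replicate m (suc M) ++ l) ≡ (m , l)
leadingCopies-replicate-++ zero [] _ = refl
leadingCopies-replicate-++ {M} zero (x ∷ l) x≤M with x ≟ suc M
... | yes refl = contradiction x≤M (n≮n M)
... | no _ = refl
leadingCopies-replicate-++ {M} (suc m) l bounded
  rewrite ≟-diag (refl {x = suc M}) | leadingCopies-replicate-++ m l bounded = refl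

leadingCopies-++ : ∀ c l → replicate (proj₁ (leadingCopies c l)) c ++ proj₂ (leadingCopies c l) ≡ l
leadingCopies-++ c [] = refl
leadingCopies-++ c (x ∷ l) with x ≟ c
... | yes refl = cong (x ∷_) (leadingCopies-++ c l)
... | no _ = refl

leadingCopies-rest : ∀ M l → NonIncPos l → OnHead (_≤ suc M) l →
                     let rest = proj₂ (leadingCopies (suc M) l) in NonIncPos rest × OnHead (_≤ M) rest
leadingCopies-rest M [] _ _ = tt , tt
leadingCopies-rest M (x ∷ l) nonInc x≤1+M with x ≟ suc M
... | yes refl = leadingCopies-rest M l (NonIncPos-tail l nonInc) (NonIncPos-head l nonInc)
... | no x≢1+M = nonInc , ≤-pred (≤∧≢⇒< x≤1+M x≢1+M)

toMultiplicities : (M : ℕ) → List ℕ → Vec ℕ M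
toMultiplicities zero l = []
toMultiplicities (suc M) l =
  proj₁ (leadingCopies (suc M) l) ∷ toMultiplicities M (proj₂ (leadingCopies (suc M) l))

fromMultiplicities : ∀ {M} → Vec ℕ M → List ℕ
fromMultiplicities [] = []
fromMultiplicities {suc M} (m ∷ v) = replicate m (suc M) ++ fromMultiplicities v

fromMultiplicities-bounded : ∀ {M} (v : Vec ℕ M) → OnHead (_≤ M) (fromMultiplicities v)
fromMultiplicities-bounded [] = tt
fromMultiplicities-bounded {suc M} (m ∷ v) =
  OnHead-replicate-++ m (fromMultiplicities v) ≤-refl
    (OnHead-map m≤n⇒m≤1+n (fromMultiplicities v) (fromMultiplicities-bounded v))

fromMultiplicities-nonInc : ∀ {M} (v : Vec ℕ M) → NonIncPos (fromMultiplicities v)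
fromMultiplicities-nonInc [] = tt
fromMultiplicities-nonInc {suc M} (m ∷ v) =
  NonIncPos-replicate-++ m (fromMultiplicities v) z<s
    (OnHead-map m≤n⇒m≤1+n (fromMultiplicities v) (fromMultiplicities-bounded v)) (fromMultiplicities-nonInc v)

toMultiplicities-fromMultiplicities : ∀ {M} (v : Vec ℕ M) → toMultiplicities M (fromMultiplicities v) ≡ v
toMultiplicities-fromMultiplicities [] = refl
toMultiplicities-fromMultiplicities {suc M} (m ∷ v)
  rewrite leadingCopies-replicate-++ m (fromMultiplicities v) (fromMultiplicities-bounded v) =
  cong (m ∷_) (toMultiplicities-fromMultiplicities v)

fromMultiplicities-toMultiplicities : ∀ M l → NonIncPos l → OnHead (_≤ M) l →
                                      fromMultiplicities (toMultiplicities M l) ≡ l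
fromMultiplicities-toMultiplicities zero [] _ _ = refl
fromMultiplicities-toMultiplicities zero (x ∷ l) nonInc x≤0 =
  contradiction (≤-trans (NonIncPos-positive l nonInc) x≤0) (n≮n 0)
fromMultiplicities-toMultiplicities (suc M) l nonInc bounded =
  trans (cong (replicate (proj₁ (leadingCopies (suc M) l)) (suc M) ++_)
              (fromMultiplicities-toMultiplicities M _ (proj₁ rest) (proj₂ rest)))
        (leadingCopies-++ (suc M) l)
  where
  rest = leadingCopies-rest M l nonInc bounded

sum-replicate : ∀ m x → sum (replicate m x) ≡ m * x
sum-replicate zero x = refl
sum-replicate (suc m) x = cong (x +_) (sum-replicate m x)

sum-map-fromMultiplicities : ∀ wt {M} (v : Vec ℕ M) → sum (map wt (fromMultiplicities v)) ≡ weight wt v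
sum-map-fromMultiplicities wt [] = refl
sum-map-fromMultiplicities wt {suc M} (m ∷ v) = begin
  sum (map wt (replicate m (suc M) ++ fromMultiplicities v))
    ≡⟨ cong sum (map-++ wt (replicate m (suc M)) (fromMultiplicities v)) ⟩
  sum (map wt (replicate m (suc M)) ++ map wt (fromMultiplicities v))
    ≡⟨ sum-++ (map wt (replicate m (suc M))) _ ⟩
  sum (map wt (replicate m (suc M))) + sum (map wt (fromMultiplicities v))
    ≡⟨ cong₂ _+_ (trans (cong sum (map-replicate wt m (suc M))) (sum-replicate m (wt (suc M))))
                 (sum-map-fromMultiplicities wt v) ⟩
  m * wt (suc M) + weight wt v ∎
  where open ≡-Reasoning

WeightedPartition : (ℕ → ℕ) → ℕ → List ℕ → Set
WeightedPartition wt n l = sum (map wt l) ≡ n × NonIncPos l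

WeightedPartition-irrelevant : ∀ {wt n} → Irrelevant (WeightedPartition wt n)
WeightedPartition-irrelevant (p , q) (p′ , q′) = cong₂ _,_ (≡-irrelevant p p′) (NonIncPos-irrelevant q q′)

multiplicities-↔ : ∀ {wt n} M → (∀ {l} → WeightedPartition wt n l → OnHead (_≤ M) l) →
                   Σ (List ℕ) (WeightedPartition wt n) ↔ Fibre (weight wt {M}) n
multiplicities-↔ {wt} M bounded =
  Σ-↔-restrict WeightedPartition-irrelevant ≡-irrelevant (toMultiplicities M) fromMultiplicities
    (λ {l} (sum≡n , nonInc) → trans (weight-toMultiplicities l (sum≡n , nonInc)) sum≡n)
    (λ {v} weight≡n → trans (sum-map-fromMultiplicities wt v) weight≡n , fromMultiplicities-nonInc v)
    (λ {l} (sum≡n , nonInc) → fromMultiplicities-toMultiplicities M l nonInc (bounded (sum≡n , nonInc)))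
    (λ {v} _ → toMultiplicities-fromMultiplicities v)
  where
  weight-toMultiplicities : ∀ l → WeightedPartition wt _ l → weight wt (toMultiplicities M l) ≡ sum (map wt l)
  weight-toMultiplicities l (sum≡n , nonInc) =
    trans (sym (sum-map-fromMultiplicities wt (toMultiplicities M l)))
          (cong (sum ∘ map wt) (fromMultiplicities-toMultiplicities M l nonInc (bounded (sum≡n , nonInc))))

IsPartition↔WeightedPartition : ∀ {n} l → IsPartition n l ↔ WeightedPartition id n l
IsPartition↔WeightedPartition l rewrite map-id l = ↔-id _

partitions-↔ : ∀ {n} M → n ≤ M → Σ (List ℕ) (IsPartition n) ↔ Fibre (weight id {M}) n
partitions-↔ {n} M n≤M =
  multiplicities-↔ M bounded ↔-∘ Σ-↔ (↔-id _) (λ {l} → IsPartition↔WeightedPartition l)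
  where
  bounded : ∀ {l} → WeightedPartition id n l → OnHead (_≤ M) l
  bounded {l} (sum≡n , _) =
    OnHead-≤-sum l (≤-trans (≤-reflexive (trans (cong sum (sym (map-id l))) sum≡n)) n≤M)

subsetWeight : ∀ {M} → Vec Bool M → ℕ
subsetWeight [] = 0
subsetWeight {suc M} (b ∷ v) = (if b then suc M else 0) + subsetWeight v

toSubset : (M : ℕ) → List ℕ → Vec Bool M
toSubset zero _ = []
toSubset (suc M) [] = false ∷ toSubset M []
toSubset (suc M) (x ∷ l) with x ≟ suc M
... | yes _ = true ∷ toSubset M l
... | no _ = false ∷ toSubset M (x ∷ l)

fromSubset : ∀ {M} → Vec Bool M → List ℕ
fromSubset [] = []
fromSubset {suc M} (true ∷ v) = suc M ∷ fromSubset v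
fromSubset {suc M} (false ∷ v) = fromSubset v

fromSubset-bounded : ∀ {M} (v : Vec Bool M) → OnHead (_≤ M) (fromSubset v)
fromSubset-bounded [] = tt
fromSubset-bounded {suc M} (true ∷ v) = ≤-refl
fromSubset-bounded {suc M} (false ∷ v) = OnHead-map m≤n⇒m≤1+n (fromSubset v) (fromSubset-bounded v)

fromSubset-decreasing : ∀ {M} (v : Vec Bool M) → DecPos (fromSubset v)
fromSubset-decreasing [] = tt
fromSubset-decreasing {suc M} (true ∷ v) =
  DecPos-∷ (fromSubset v) (OnHead-map s≤s (fromSubset v) (fromSubset-bounded v)) (fromSubset-decreasing v) z<s
fromSubset-decreasing {suc M} (false ∷ v) = fromSubset-decreasing v

toSubset-fromSubset : ∀ {M} (v : Vec Bool M) → toSubset M (fromSubset v) ≡ v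
toSubset-fromSubset [] = refl
toSubset-fromSubset {suc M} (true ∷ v) rewrite ≟-diag (refl {x = suc M}) = cong (true ∷_) (toSubset-fromSubset v)
toSubset-fromSubset {suc M} (false ∷ v) = skip (fromSubset v) (fromSubset-bounded v) (toSubset-fromSubset v)
  where
  skip : ∀ l → OnHead (_≤ M) l → toSubset M l ≡ v → toSubset (suc M) l ≡ false ∷ v
  skip [] _ eq = cong (false ∷_) eq
  skip (x ∷ l) x≤M eq with x ≟ suc M
  ... | yes refl = contradiction x≤M (n≮n M)
  ... | no _ = cong (false ∷_) eq

fromSubset-toSubset : ∀ M l → DecPos l → OnHead (_≤ M) l → fromSubset (toSubset M l) ≡ l
fromSubset-toSubset zero [] _ _ = refl
fromSubset-toSubset zero (x ∷ l) dec x≤0 = contradiction (≤-trans (DecPos-positive l dec) x≤0) (n≮n 0)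
fromSubset-toSubset (suc M) [] _ _ = fromSubset-toSubset M [] tt tt
fromSubset-toSubset (suc M) (x ∷ l) dec x≤1+M with x ≟ suc M
... | yes refl =
  cong (suc M ∷_) (fromSubset-toSubset M l (DecPos-tail l dec) (OnHead-map ≤-pred l (DecPos-head l dec)))
... | no x≢1+M = fromSubset-toSubset M (x ∷ l) dec (≤-pred (≤∧≢⇒< x≤1+M x≢1+M))

sum-fromSubset : ∀ {M} (v : Vec Bool M) → sum (fromSubset v) ≡ subsetWeight v
sum-fromSubset [] = refl
sum-fromSubset {suc M} (true ∷ v) = cong (suc M +_) (sum-fromSubset v)
sum-fromSubset {suc M} (false ∷ v) = sum-fromSubset v

IsDistinctPartition-irrelevant : ∀ {n} → Irrelevant (IsDistinctPartition n)
IsDistinctPartition-irrelevant (p , q) (p′ , q′) = cong₂ _,_ (≡-irrelevant p p′) (DecPos-irrelevant q q′)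

distinctPartitions-↔ : ∀ {n} M → n ≤ M → Σ (List ℕ) (IsDistinctPartition n) ↔ Fibre (subsetWeight {M}) n
distinctPartitions-↔ {n} M n≤M =
  Σ-↔-restrict IsDistinctPartition-irrelevant ≡-irrelevant (toSubset M) fromSubset
    (λ {l} (sum≡n , dec) →
       trans (sym (sum-fromSubset (toSubset M l))) (trans (cong sum (inverse l sum≡n dec)) sum≡n))
    (λ {v} weight≡n → trans (sum-fromSubset v) weight≡n , fromSubset-decreasing v)
    (λ {l} (sum≡n , dec) → inverse l sum≡n dec)
    (λ {v} _ → toSubset-fromSubset v)
  where
  inverse : ∀ l → sum l ≡ n → DecPos l → fromSubset (toSubset M l) ≡ l
  inverse l sum≡n dec = fromSubset-toSubset M l dec (OnHead-≤-sum l (≤-trans (≤-reflexive sum≡n) n≤M))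

-- Splitting multiplicity vectors

interleave : Vec A K × Vec A K → Vec A (double K)
interleave ([] , []) = []
interleave (x ∷ xs , y ∷ ys) = x ∷ y ∷ interleave (xs , ys)

deinterleave : Vec A (double K) → Vec A K × Vec A K
deinterleave {K = zero} [] = [] , []
deinterleave {K = suc K} (x ∷ y ∷ v) = Product.map (x ∷_) (y ∷_) (deinterleave v)

interleave-↔ : (Vec A K × Vec A K) ↔ Vec A (double K)
interleave-↔ = mk↔ₛ′ interleave deinterleave interleave-deinterleave deinterleave-interleave
  where
  interleave-deinterleave : ∀ {K} (v : Vec _ (double K)) → interleave (deinterleave v) ≡ v
  interleave-deinterleave {K = zero} [] = refl
  interleave-deinterleave {K = suc K} (x ∷ y ∷ v) = cong (λ v′ → x ∷ y ∷ v′) (interleave-deinterleave v)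
  deinterleave-interleave : ∀ {K} (uv : Vec _ K × Vec _ K) → deinterleave (interleave uv) ≡ uv
  deinterleave-interleave ([] , []) = refl
  deinterleave-interleave (x ∷ xs , y ∷ ys) =
    cong (Product.map (x ∷_) (y ∷_)) (deinterleave-interleave (xs , ys))

weight-interleave : ∀ wt (u v : Vec ℕ K) →
                    weight wt (interleave (u , v)) ≡ weight (wt ∘ double) u + weight (wt ∘ pred ∘ double) v
weight-interleave wt [] [] = refl
weight-interleave {K = suc K} wt (x ∷ u) (y ∷ v) rewrite weight-interleave wt u v =
  regroup (x * wt (double (suc K))) (y * wt (suc (double K)))
          (weight (wt ∘ double) u) (weight (wt ∘ pred ∘ double) v)
  where
  regroup : ∀ a b c d → a + (b + (c + d)) ≡ (a + c) + (b + d)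
  regroup = solve-∀

Vec-unzip-↔ : A ↔ (B × C) → Vec A K ↔ (Vec B K × Vec C K)
Vec-unzip-↔ φ = mk↔ₛ′ (Vec.unzip ∘ Vec.map to) (Vec.map from ∘ uncurry Vec.zip) to-from from-to
  where
  open Inverse φ
  open ≡-Reasoning
  to-from : ∀ (bcs : Vec _ _ × Vec _ _) → Vec.unzip (Vec.map to (Vec.map from (uncurry Vec.zip bcs))) ≡ bcs
  to-from (bs , cs) = begin
    Vec.unzip (Vec.map to (Vec.map from (Vec.zip bs cs)))
      ≡⟨ cong Vec.unzip (Vecₚ.map-∘ to from (Vec.zip bs cs)) ⟨
    Vec.unzip (Vec.map (to ∘ from) (Vec.zip bs cs))
      ≡⟨ cong Vec.unzip (trans (Vecₚ.map-cong strictlyInverseˡ _) (Vecₚ.map-id (Vec.zip bs cs))) ⟩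
    Vec.unzip (Vec.zip bs cs)
      ≡⟨ Vecₚ.unzip∘zip bs cs ⟩
    (bs , cs) ∎
  from-to : ∀ as → Vec.map from (uncurry Vec.zip (Vec.unzip (Vec.map to as))) ≡ as
  from-to as = begin
    Vec.map from (uncurry Vec.zip (Vec.unzip (Vec.map to as)))
      ≡⟨ cong (Vec.map from) (Vecₚ.zip∘unzip (Vec.map to as)) ⟩
    Vec.map from (Vec.map to as)
      ≡⟨ Vecₚ.map-∘ from to as ⟨
    Vec.map (from ∘ to) as
      ≡⟨ trans (Vecₚ.map-cong strictlyInverseʳ as) (Vecₚ.map-id as) ⟩
    as ∎

halve : ℕ → Bool × ℕ
halve m with parity m
... | even k = false , k
... | odd k = true , k

unhalve : Bool × ℕ → ℕ
unhalve (false , k) = double k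
unhalve (true , k) = suc (double k)

ℕ↔Bool×ℕ : ℕ ↔ (Bool × ℕ)
ℕ↔Bool×ℕ = mk↔ₛ′ halve unhalve halve-unhalve unhalve-halve
  where
  halve-unhalve : ∀ bk → halve (unhalve bk) ≡ bk
  halve-unhalve (false , k) rewrite parity-double k = refl
  halve-unhalve (true , k) rewrite parity-suc-double k = refl
  unhalve-halve : ∀ m → unhalve (halve m) ≡ m
  unhalve-halve m with parity m
  ... | even k = refl
  ... | odd k = refl

bitsAndHalves-↔ : Vec ℕ K ↔ (Vec Bool K × Vec ℕ K)
bitsAndHalves-↔ = Vec-unzip-↔ ℕ↔Bool×ℕ

weight-bitsAndHalves : ∀ (bs : Vec Bool K) qs →
                       weight id (Inverse.from bitsAndHalves-↔ (bs , qs)) ≡ subsetWeight bs + weight double qs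
weight-bitsAndHalves [] [] = refl
weight-bitsAndHalves {suc K} (b ∷ bs) (q ∷ qs) rewrite weight-bitsAndHalves bs qs =
  trans (cong (_+ (subsetWeight bs + weight double qs)) (unhalve-* b))
        (regroup (if b then suc K else 0) (q * double (suc K)) (subsetWeight bs) (weight double qs))
  where
  unhalve-* : ∀ b → unhalve (b , q) * suc K ≡ (if b then suc K else 0) + q * double (suc K)
  unhalve-* false = double-* q (suc K)
  unhalve-* true = cong (suc K +_) (double-* q (suc K))
  regroup : ∀ a b c d → (a + b) + (c + d) ≡ (a + c) + (b + d)
  regroup = solve-∀

weight-double : ∀ (v : Vec ℕ K) → weight double v ≡ double (weight id v)
weight-double [] = refl
weight-double {suc K} (m ∷ v) =
  trans (cong₂ _+_ (*-double m (suc K)) (weight-double v)) (sym (double-+ (m * suc K) (weight id v)))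

-- 01-partitions as partitions with halved even parts

LastPositive-irrelevant : Irrelevant LastPositive
LastPositive-irrelevant {[]} _ _ = refl
LastPositive-irrelevant {x ∷ []} = ≤-irrelevant
LastPositive-irrelevant {x ∷ y ∷ l} = LastPositive-irrelevant {y ∷ l}

JaggedConds-irrelevant : Irrelevant JaggedConds
JaggedConds-irrelevant {[]} _ _ = refl
JaggedConds-irrelevant {x ∷ []} _ _ = refl
JaggedConds-irrelevant {x ∷ y ∷ []} = ≤-irrelevant
JaggedConds-irrelevant {x ∷ y ∷ z ∷ l} (p , q , r) (p′ , q′ , r′) =
  cong₂ _,_ (≤-irrelevant p p′) (cong₂ _,_ (≤-irrelevant q q′) (JaggedConds-irrelevant r r′))

Is01Partition-irrelevant : ∀ {n} → Irrelevant (Is01Partition n)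
Is01Partition-irrelevant {x = l} (p , q , r) (p′ , q′ , r′) =
  cong₂ _,_ (≡-irrelevant p p′)
            (cong₂ _,_ (LastPositive-irrelevant {l} q q′) (JaggedConds-irrelevant {l} r r′))

LastPositive-tail : ∀ {x} l → LastPositive (x ∷ l) → LastPositive l
LastPositive-tail [] _ = tt
LastPositive-tail (y ∷ l) lp = lp

LastPositive-++ : ∀ l {t} → LastPositive t → (t ≡ [] → LastPositive l) → LastPositive (l ++ t)
LastPositive-++ [] lp _ = lp
LastPositive-++ (x ∷ []) {[]} _ lp = lp refl
LastPositive-++ (x ∷ []) {y ∷ t} lp _ = lp
LastPositive-++ (x ∷ y ∷ l) lp lpˡ = LastPositive-++ (y ∷ l) lp lpˡ

JaggedConds-∷ : ∀ {x} t → OnHead (_≤ suc x) t → OnHead (_≤ x) (drop 1 t) → JaggedConds t →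
                JaggedConds (x ∷ t)
JaggedConds-∷ [] _ _ _ = tt
JaggedConds-∷ (y ∷ []) y≤1+x _ _ = y≤1+x
JaggedConds-∷ (y ∷ z ∷ t) y≤1+x z≤x jc = y≤1+x , z≤x , jc

JaggedConds-tail : ∀ {x} t → JaggedConds (x ∷ t) → JaggedConds t
JaggedConds-tail [] _ = tt
JaggedConds-tail (y ∷ []) _ = tt
JaggedConds-tail (y ∷ z ∷ t) (_ , _ , jc) = jc

JaggedConds-next : ∀ {x y} t → JaggedConds (x ∷ y ∷ t) → y ≤ suc x
JaggedConds-next [] y≤1+x = y≤1+x
JaggedConds-next (z ∷ t) (y≤1+x , _) = y≤1+x

JaggedConds-skip : ∀ {x y} t → JaggedConds (x ∷ y ∷ t) → OnHead (_≤ x) t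
JaggedConds-skip [] _ = tt
JaggedConds-skip (z ∷ t) (_ , z≤x , _) = z≤x

block : ℕ → List ℕ
block c with parity c
... | even v = v ∷ []
... | odd x = x ∷ suc x ∷ []

codeWeight : ℕ → ℕ
codeWeight c with parity c
... | even v = v
... | odd x = suc (double x)

decode : List ℕ → List ℕ
decode [] = []
decode (c ∷ cs) = block c ++ decode cs

encode : List ℕ → List ℕ
encode∷ : ℕ → List ℕ → List ℕ

encode [] = []
encode (x ∷ l) = encode∷ x l

encode∷ x [] = double x ∷ []
encode∷ x (y ∷ l) with y ≟ suc x
... | yes _ = suc (double x) ∷ encode l
... | no _ = double x ∷ encode∷ y l

sum-block : ∀ c → sum (block c) ≡ codeWeight c
sum-block c with parity c
... | even v = +-identityʳ v
... | odd x = trans (cong (x +_) (+-identityʳ (suc x))) (trans (+-suc x x) (cong suc (sym (double≡+ x))))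

sum-decode : ∀ cs → sum (decode cs) ≡ sum (map codeWeight cs)
sum-decode [] = refl
sum-decode (c ∷ cs) = trans (sum-++ (block c) (decode cs)) (cong₂ _+_ (sum-block c) (sum-decode cs))

codeWeight-double : ∀ k → codeWeight (double k) ≡ k
codeWeight-double k rewrite parity-double k = refl

codeWeight-pred-double : ∀ k → codeWeight (pred (double k)) ≡ pred (double k)
codeWeight-pred-double zero = refl
codeWeight-pred-double (suc k) rewrite parity-suc-double k = refl

codes-bounded : ∀ cs → OnHead (_≤ double (sum (map codeWeight cs))) cs
codes-bounded [] = tt
codes-bounded (c ∷ cs) = ≤-trans (code≤double-codeWeight c) (double-mono-≤ (m≤m+n (codeWeight c) _))
  where
  code≤double-codeWeight : ∀ c → c ≤ double (codeWeight c)
  code≤double-codeWeight c with parity c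
  ... | even v = ≤-refl
  ... | odd x = n≤double[n] (suc (double x))

block-double : ∀ v → block (double v) ≡ v ∷ []
block-double v rewrite parity-double v = refl

block-suc-double : ∀ x → block (suc (double x)) ≡ x ∷ suc x ∷ []
block-suc-double x rewrite parity-suc-double x = refl

decode-encode : ∀ l → decode (encode l) ≡ l
decode-encode∷ : ∀ x l → decode (encode∷ x l) ≡ x ∷ l

decode-encode [] = refl
decode-encode (x ∷ l) = decode-encode∷ x l

decode-encode∷ x [] = cong (_++ []) (block-double x)
decode-encode∷ x (y ∷ l) with y ≟ suc x
... | yes refl = cong₂ _++_ (block-suc-double x) (decode-encode l)
... | no _ = cong₂ _++_ (block-double x) (decode-encode∷ y l)

decode-lastPositive : ∀ cs → NonIncPos cs → LastPositive (decode cs)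
decode-lastPositive [] _ = tt
decode-lastPositive (c ∷ cs) nonInc =
  LastPositive-++ (block c) (decode-lastPositive cs (NonIncPos-tail cs nonInc))
                  (λ _ → block-lastPositive c (NonIncPos-positive cs nonInc))
  where
  block-lastPositive : ∀ c → c > 0 → LastPositive (block c)
  block-lastPositive c c>0 with parity c
  ... | even zero = contradiction c>0 (n≮n 0)
  ... | even (suc v) = z<s
  ... | odd x = z<s

decode-bounded : ∀ {c} cs → NonIncPos cs → OnHead (_≤ c) cs →
                 OnHead (λ y → double y ≤ c) (decode cs) ×
                 OnHead (λ z → double z ≤ suc c) (drop 1 (decode cs))
decode-bounded [] _ _ = tt , tt
decode-bounded {c} (c′ ∷ cs) nonInc c′≤c with parity c′
... | even v = c′≤c , OnHead-map (λ 2y≤2v → ≤-trans 2y≤2v (≤-trans c′≤c (n≤1+n c))) (decode cs)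
                        (proj₁ (decode-bounded cs (NonIncPos-tail cs nonInc) (NonIncPos-head cs nonInc)))
... | odd x = ≤-trans (n≤1+n _) c′≤c , s≤s c′≤c

decode-jaggedConds : ∀ cs → NonIncPos cs → JaggedConds (decode cs)
decode-jaggedConds [] _ = tt
decode-jaggedConds (c ∷ cs) nonInc
  with parity c | decode-bounded cs (NonIncPos-tail cs nonInc) (NonIncPos-head cs nonInc)
     | decode-jaggedConds cs (NonIncPos-tail cs nonInc)
... | even v | first , second | rest =
  JaggedConds-∷ (decode cs) (OnHead-map (λ 2y≤2v → m≤n⇒m≤1+n (double-cancel-≤ 2y≤2v)) (decode cs) first)
    (OnHead-map double≤1+double⇒≤ (drop 1 (decode cs)) second) rest
... | odd x | first , second | rest =
  JaggedConds-∷ (suc x ∷ decode cs) ≤-refl (OnHead-map double≤1+double⇒≤ (decode cs) first)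
    (JaggedConds-∷ (decode cs)
      (OnHead-map (λ 2y≤2x+1 → m≤n⇒m≤1+n (m≤n⇒m≤1+n (double≤1+double⇒≤ 2y≤2x+1))) (decode cs) first)
      (OnHead-map double-cancel-≤ (drop 1 (decode cs)) second) rest)

encode-pair : ∀ x l → encode (x ∷ suc x ∷ l) ≡ suc (double x) ∷ encode l
encode-pair x l rewrite ≟-diag (refl {x = suc x}) = refl

encode-single : ∀ x l → OnHead (_≤ x) l → encode (x ∷ l) ≡ double x ∷ encode l
encode-single x [] _ = refl
encode-single x (y ∷ l) y≤x with y ≟ suc x
... | yes refl = contradiction y≤x (n≮n x)
... | no _ = refl

encode-decode : ∀ cs → NonIncPos cs → encode (decode cs) ≡ cs
encode-decode [] _ = refl
encode-decode (c ∷ cs) nonInc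
  with parity c | decode-bounded cs (NonIncPos-tail cs nonInc) (NonIncPos-head cs nonInc)
... | even v | first , _ =
  trans (encode-single v (decode cs) (OnHead-map double-cancel-≤ (decode cs) first))
        (cong (double v ∷_) (encode-decode cs (NonIncPos-tail cs nonInc)))
... | odd x | _ =
  trans (encode-pair x (decode cs)) (cong (suc (double x) ∷_) (encode-decode cs (NonIncPos-tail cs nonInc)))

encode∷-≢[] : ∀ x l → encode∷ x l ≢ []
encode∷-≢[] x [] ()
encode∷-≢[] x (y ∷ l) with y ≟ suc x
... | yes _ = λ ()
... | no _ = λ ()

encode∷-head-≤ : ∀ x l → OnHead (_≤ suc (double x)) (encode∷ x l)
encode∷-head-≤ x [] = n≤1+n _
encode∷-head-≤ x (y ∷ l) with y ≟ suc x
... | yes _ = ≤-refl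
... | no _ = n≤1+n _

encode∷-head-≤-double : ∀ {x y} l → y ≤ x → OnHead (_≤ x) l → OnHead (_≤ double x) (encode∷ y l)
encode∷-head-≤-double [] y≤x _ = double-mono-≤ y≤x
encode∷-head-≤-double {y = y} (z ∷ l) y≤x z≤x with z ≟ suc y
... | yes refl = ≤-trans (n≤1+n _) (double-mono-≤ z≤x)
... | no _ = double-mono-≤ y≤x

encode-nonInc : ∀ l → LastPositive l → JaggedConds l → NonIncPos (encode l)
encode∷-nonInc : ∀ x l → LastPositive (x ∷ l) → JaggedConds (x ∷ l) → NonIncPos (encode∷ x l)

encode-nonInc [] _ _ = tt
encode-nonInc (x ∷ l) = encode∷-nonInc x l

encode∷-nonInc zero [] () _
encode∷-nonInc (suc x) [] _ _ = z<s
encode∷-nonInc x (y ∷ l) lp jc with y ≟ suc x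
... | yes refl =
  NonIncPos-∷ (encode l) (pair-bound l (JaggedConds-skip l jc))
    (encode-nonInc l (LastPositive-tail l lp) (JaggedConds-tail l (JaggedConds-tail (suc x ∷ l) jc))) (λ _ → z<s)
  where
  pair-bound : ∀ l → OnHead (_≤ x) l → OnHead (_≤ suc (double x)) (encode l)
  pair-bound [] _ = tt
  pair-bound (z ∷ l) z≤x =
    OnHead-map (λ c≤ → ≤-trans c≤ (s≤s (double-mono-≤ z≤x))) (encode∷ z l) (encode∷-head-≤ z l)
... | no y≢1+x =
  NonIncPos-∷ (encode∷ y l) (encode∷-head-≤-double l y≤x (JaggedConds-skip l jc))
    (encode∷-nonInc y l lp (JaggedConds-tail (y ∷ l) jc)) (λ eq → contradiction eq (encode∷-≢[] y l))
  where
  y≤x = ≤-pred (≤∧≢⇒< (JaggedConds-next l jc) y≢1+x)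

jaggedEncoding-↔ : ∀ {n} → Σ (List ℕ) (Is01Partition n) ↔ Σ (List ℕ) (WeightedPartition codeWeight n)
jaggedEncoding-↔ =
  Σ-↔-restrict Is01Partition-irrelevant WeightedPartition-irrelevant encode decode
    (λ {l} (sum≡n , lp , jc) →
       trans (sym (sum-decode (encode l))) (trans (cong sum (decode-encode l)) sum≡n) , encode-nonInc l lp jc)
    (λ {cs} (sum≡n , nonInc) →
       trans (sum-decode cs) sum≡n , decode-lastPositive cs nonInc , decode-jaggedConds cs nonInc)
    (λ {l} _ → decode-encode l)
    (λ {cs} (_ , nonInc) → encode-decode cs nonInc)

-- Counting the three kinds of partitions

partitions-count : ∀ {p} → Counts p IsPartition → ∀ M → CountsUpTo M p (weight id {M})
partitions-count hp M n n≤M = partitions-↔ M n≤M ↔-∘ hp n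

distinctPartitions-count : ∀ {d} → Counts d IsDistinctPartition → ∀ M → CountsUpTo M d (subsetWeight {M})
distinctPartitions-count hd M n n≤M = distinctPartitions-↔ M n≤M ↔-∘ hd n

evenPartitions-count : ∀ {p} → Counts p IsPartition → ∀ K → CountsUpTo K (dilate p) (weight double {K})
evenPartitions-count hp K = CountsUpTo-↔ (↔-id _) weight-double (CountsUpTo-dilate (partitions-count hp K))

jaggedPartitions-count : ∀ {j} → Counts j Is01Partition → ∀ K →
                       CountsUpTo K j (weight id {K} ⊕ weight (pred ∘ double) {K})
jaggedPartitions-count {j} hj K = CountsUpTo-↔⁻¹ interleave-↔ preserves codeCount
  where
  codeCount : CountsUpTo K j (weight codeWeight {double K})
  codeCount n n≤K = multiplicities-↔ (double K) bounded ↔-∘ (jaggedEncoding-↔ ↔-∘ hj n)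
    where
    bounded : ∀ {cs} → WeightedPartition codeWeight n cs → OnHead (_≤ double K) cs
    bounded {cs} (sum≡n , _) =
      OnHead-map (λ c≤ → ≤-trans c≤ (double-mono-≤ (≤-trans (≤-reflexive sum≡n) n≤K))) cs (codes-bounded cs)
  preserves : ∀ uv → weight codeWeight (interleave uv) ≡ (weight id ⊕ weight (pred ∘ double)) uv
  preserves (u , v) = trans (weight-interleave codeWeight u v)
                            (cong₂ _+_ (weight-cong codeWeight-double u) (weight-cong codeWeight-pred-double v))

partitions-of-zero : ∀ {p} → Counts p IsPartition → p 0 ≡ 1
partitions-of-zero hp = ↔⇒≡ (emptyVector ↔-∘ partitions-count hp 0 0 z≤n)
  where
  emptyVector : Fibre (weight id {0}) 0 ↔ Fin 1
  emptyVector =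
    mk↔ₛ′ (λ _ → fzero) (λ _ → [] , refl) (λ { fzero → refl ; (fsuc ()) }) (λ { ([] , refl) → refl })

jagged×even-count : ∀ {j p} → Counts j Is01Partition → Counts p IsPartition → ∀ K →
                    CountsUpTo K (convolution j (dilate p)) (weight id {K} ⊕ weight id {double K})
jagged×even-count hj hp K =
  CountsUpTo-regroup {wa = weight id} {wd = weight id} (interleave-↔ ↔-∘ ×-comm _ _) preserves
    (CountsUpTo-× (jaggedPartitions-count hj K) (evenPartitions-count hp K))
  where
  preserves : ∀ ((o , e) : Vec ℕ K × Vec ℕ K) →
              weight id (interleave (e , o)) ≡ weight (pred ∘ double) o + weight double e
  preserves (o , e) = trans (weight-interleave id e o) (+-comm (weight double e) (weight (pred ∘ double) o))

partitions×distinct×even-count :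
  ∀ {p d} → Counts p IsPartition → Counts d IsDistinctPartition → ∀ K →
  CountsUpTo K (convolution (convolution p d) (dilate p)) (weight id {K} ⊕ weight id {K})
partitions×distinct×even-count hp hd K =
  CountsUpTo-regroup {wa = weight id} {wd = weight id} (↔-sym bitsAndHalves-↔)
    (λ (bs , qs) → weight-bitsAndHalves bs qs)
    (CountsUpTo-× (CountsUpTo-× (partitions-count hp K) (distinctPartitions-count hd K))
                  (evenPartitions-count hp K))

corollary5 : (j p d : ℕ → ℕ) → Counts j Is01Partition → Counts p IsPartition
             → Counts d IsDistinctPartition → (n : ℕ) → j n ≡ convolution p d n
corollary5 j p d hj hp hd n =
  convolution-cancelʳ {f = j} {g = convolution p d} {c = dilate p} n
    (partitions-of-zero hp) sameCoefficients n ≤-refl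
  where
  P = partitions-count hp
  sameCoefficients : ∀ m → m ≤ n → convolution j (dilate p) m ≡ convolution (convolution p d) (dilate p) m
  sameCoefficients m m≤n = begin
    convolution j (dilate p) m
      ≡⟨ CountsUpTo-unique (jagged×even-count hj hp n)
                           (CountsUpTo-× (P n) (CountsUpTo-≤ (n≤double[n] n) (P (double n)))) m≤n ⟩
    convolution p p m
      ≡⟨ CountsUpTo-unique (CountsUpTo-× (P n) (P n)) (partitions×distinct×even-count hp hd n) m≤n ⟩
    convolution (convolution p d) (dilate p) m ∎
    where open ≡-Reasoning
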